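{- There exists a sequence of Boolean functions $f_1,f_2,\ldots$ such that $f_j$ uses $O(2^j)$ variables, every compressed SDD representing $f_j$ has size $\Omega(2^j)$ with respect to any vtree, and there is a vtree with respect to which a compressed VS-SDD representing $f_j$ has size $O(j)$.
   Context: A vtree over a set of variables is an ordered full binary tree whose leaves are in one-to-one correspondence with the variables; $l(x)$ is the variable of leaf $x$; nodes have integer IDs $\mathtt{ID}(x)$ assigned in preorder, $\mathtt{ID}^{ -1}(i)$ the node with ID $i$. $y$ is a left (right) descendant of $x$ if it is a (not necessarily proper) descendant of the left (right) child of $x$. For disjoint $\mathbf{X},\mathbf{Y}$, an $\mathbf{X}$-partition of $f(\mathbf{X},\mathbf{Y})$ is $f=\bigvee_{i=1}^n[p_i(\mathbf{X})\wedge s_i(\mathbf{Y})]$ with pairwise disjoint primes $p_i$, $\bigvee p_i=\mathit{true}$, $p_i\ne\mathit{false}$; it is compressed if the subs $s_i$ are pairwise distinct. SDD respecting vtree node $x$: $\top,\bot$ (true/false); literals $X,\neg X$ with $x$ the leaf of $X$; decompositions $\{(p_1,s_1),\ldots,(p_n,s_n)\}$ with $x$ internal, $p_i$ SDDs respecting left descendants of $x$, $s_i$ SDDs respecting right descendants of $x$, $\langle p_i\rangle$ forming a partition, semantics $\bigvee_i\langle p_i\rangle\wedge\langle s_i\rangle$. Size = sum over decomposition nodes of their number of elements. An SDD is compressed if all its partitions are compressed. A VS-SDD is a pair $(\alpha,k)$ of a structure and integer offset: $\top,\bot$ constants; literal $\mathbf{v}$ ($\neg\mathbf{v}$) with $\mathtt{ID}^{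 -1}(k)$ a leaf means $l(\mathtt{ID}^{ -1}(k))$ (its negation); decomposition $\{([p_i,d_i],[s_i,e_i])\}_{i=1}^n$ with $\mathtt{ID}^{ -1}(k)$ internal, $\mathtt{ID}^{ -1}(d_i+k)$ a left and $\mathtt{ID}^{ -1}(e_i+k)$ a right descendant of $\mathtt{ID}^{ -1}(k)$, $\langle p_i,d_i+k\rangle$ forming a partition, meaning $\bigvee_i\langle p_i,d_i+k\rangle\wedge\langle s_i,e_i+k\rangle$. Structures are DAG nodes; identical structures are shared only when their offsets correspond to vtree nodes with isomorphic subtrees. Size = sum over distinct decomposition nodes of the number of elements. A VS-SDD is compressed if every decomposition in it forms a compressed partition. -}

module Defs where

open import Data.Nat as ℕ using (ℕ; zero; suc; _+_; _∸_; _<ᵇ_)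
open import Data.Bool as B using (Bool; true; false; _∧_; _∨_; not; if_then_else_)
open import Data.Fin as F using (Fin)
open import Data.Integer as ℤ using (ℤ; +_; -[1+_])
open import Data.Nat.ListAction using (sum)
open import Data.List using (List; []; _∷_; map; length; allFin; deduplicate; foldr)
open import Data.List.Relation.Unary.AllPairs using (AllPairs)
open import Data.List.Relation.Binary.Permutation.Propositional using (_↭_)
open import Data.Maybe using (Maybe; just; nothing)
import Data.Maybe.Properties as MP
import Data.Product.Properties as PP
open import Data.Product using (Σ; _×_; _,_; proj₁; proj₂)
open import Data.Unit using (⊤; tt)
open import Data.Empty using (⊥)
open import Relation.Nullary using (Dec; yes; no; ¬_)
open import Relation.Binary.PropositionalEquality using (_≡_; refl; cong)
open import Relation.Binary.Definitions using (DecidableEquality)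

private variable n : ℕ

BoolFun : ℕ → Set
BoolFun n = (Fin n → Bool) → Bool

IsPartition : List (BoolFun n) → Set
IsPartition ps =
    AllPairs (λ p q → ∀ a → (p a ∧ q a) ≡ false) ps
  × (∀ a → foldr (λ p b → p a ∨ b) false ps ≡ true)
  × Data.List.Relation.Unary.All.All (λ p → ¬ (∀ a → p a ≡ false)) ps
  where import Data.List.Relation.Unary.All

PairwiseDistinct : List (BoolFun n) → Set
PairwiseDistinct ss = AllPairs (λ s t → ¬ (∀ a → s a ≡ t a)) ss

data VTree (n : ℕ) : Set where
  leaf : Fin n → VTree n
  node : VTree n → VTree n → VTree n

leaves : VTree n → List (Fin n)
leaves (leaf x) = x ∷ []
leaves (node l r) = Data.List._++_ (leaves l) (leaves r)

IsVtree : VTree n → Set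
IsVtree {n} t = leaves t ↭ allFin n

data Desc {n : ℕ} : VTree n → VTree n → Set where
  here  : ∀ {x} → Desc x x
  left  : ∀ {y l r} → Desc y l → Desc y (node l r)
  right : ∀ {y l r} → Desc y r → Desc y (node l r)

count : VTree n → ℕ
count (leaf _) = 1
count (node l r) = suc (count l + count r)

-- ID⁻¹ : the node with preorder ID i (IDs start at 0 at the root)
nodeAt : VTree n → ℕ → Maybe (VTree n)
nodeAt t zero = just t
nodeAt (leaf _) (suc i) = nothing
nodeAt (node l r) (suc i) =
  if i <ᵇ count l then nodeAt l i else nodeAt r (i ∸ count l)

nodeAtℤ : VTree n → ℤ → Maybe (VTree n)
nodeAtℤ t (+ i) = nodeAt t i
nodeAtℤ t -[1+ _ ] = nothing

-- shape of a subtree (for isomorphism of subtrees)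
data Shape : Set where
  sleaf : Shape
  snode : Shape → Shape → Shape

shape : VTree n → Shape
shape (leaf _) = sleaf
shape (node l r) = snode (shape l) (shape r)

_≟Sh_ : DecidableEquality Shape
sleaf ≟Sh sleaf = yes refl
sleaf ≟Sh snode _ _ = no λ ()
snode _ _ ≟Sh sleaf = no λ ()
snode a b ≟Sh snode c d with a ≟Sh c | b ≟Sh d
... | yes refl | yes refl = yes refl
... | no ne | _ = no λ { refl → ne refl }
... | _ | no ne = no λ { refl → ne refl }

-- SDDs (trees; sharing is accounted for in the size by counting
-- syntactically distinct decomposition nodes)

data SDD (n : ℕ) : Set where
  const : Bool → SDD n
  lit   : Bool → Fin n → SDD n
  dec   : List (SDD n × SDD n) → SDD n

mutual
  ⟦_⟧ : SDD n → BoolFun n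
  ⟦ const b ⟧ a = b
  ⟦ lit b X ⟧ a = if b then a X else not (a X)
  ⟦ dec es ⟧ a = ⟦ es ⟧ᵉ a

  ⟦_⟧ᵉ : List (SDD n × SDD n) → BoolFun n
  ⟦ [] ⟧ᵉ a = false
  ⟦ (p , s) ∷ es ⟧ᵉ a = (⟦ p ⟧ a ∧ ⟦ s ⟧ a) ∨ ⟦ es ⟧ᵉ a

primes : List (SDD n × SDD n) → List (BoolFun n)
primes es = map (λ e → ⟦ proj₁ e ⟧) es

subs : List (SDD n × SDD n) → List (BoolFun n)
subs es = map (λ e → ⟦ proj₂ e ⟧) es

mutual
  Respects : SDD n → VTree n → Set
  Respects (const _) x = ⊤
  Respects (lit _ X) (leaf Y) = X ≡ Y
  Respects (lit _ _) (node _ _) = ⊥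
  Respects (dec es) (leaf _) = ⊥
  Respects (dec es) (node l r) = RespectsElems es l r × IsPartition (primes es)

  RespectsElems : List (SDD n × SDD n) → VTree n → VTree n → Set
  RespectsElems [] l r = ⊤
  RespectsElems ((p , s) ∷ es) l r =
      Σ (VTree _) (λ y → Desc y l × Respects p y)
    × Σ (VTree _) (λ z → Desc z r × Respects s z)
    × RespectsElems es l r

mutual
  Compressed : SDD n → Set
  Compressed (const _) = ⊤
  Compressed (lit _ _) = ⊤
  Compressed (dec es) = CompressedElems es × PairwiseDistinct (subs es)

  CompressedElems : List (SDD n × SDD n) → Set
  CompressedElems [] = ⊤
  CompressedElems ((p , s) ∷ es) = Compressed p × Compressed s × CompressedElems es

mutual
  _≟S_ : DecidableEquality (SDD n)
  const a ≟S const b with a B.≟ b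
  ... | yes refl = yes refl
  ... | no ne = no λ { refl → ne refl }
  const _ ≟S lit _ _ = no λ ()
  const _ ≟S dec _ = no λ ()
  lit _ _ ≟S const _ = no λ ()
  lit b X ≟S lit c Y with b B.≟ c | X F.≟ Y
  ... | yes refl | yes refl = yes refl
  ... | no ne | _ = no λ { refl → ne refl }
  ... | _ | no ne = no λ { refl → ne refl }
  lit _ _ ≟S dec _ = no λ ()
  dec _ ≟S const _ = no λ ()
  dec _ ≟S lit _ _ = no λ ()
  dec es ≟S dec fs with es ≟Es fs
  ... | yes refl = yes refl
  ... | no ne = no λ { refl → ne refl }

  _≟Es_ : DecidableEquality (List (SDD n × SDD n))
  [] ≟Es [] = yes refl
  [] ≟Es (_ ∷ _) = no λ ()
  (_ ∷ _) ≟Es [] = no λ ()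
  ((p , s) ∷ es) ≟Es ((q , t) ∷ fs) with p ≟S q | s ≟S t | es ≟Es fs
  ... | yes refl | yes refl | yes refl = yes refl
  ... | no ne | _ | _ = no λ { refl → ne refl }
  ... | _ | no ne | _ = no λ { refl → ne refl }
  ... | _ | _ | no ne = no λ { refl → ne refl }

mutual
  decNodes : SDD n → List (SDD n)
  decNodes (const _) = []
  decNodes (lit _ _) = []
  decNodes (dec es) = dec es ∷ decNodesᵉ es

  decNodesᵉ : List (SDD n × SDD n) → List (SDD n)
  decNodesᵉ [] = []
  decNodesᵉ ((p , s) ∷ es) =
    Data.List._++_ (decNodes p) (Data.List._++_ (decNodes s) (decNodesᵉ es))

elemCount : SDD n → ℕ
elemCount (dec es) = length es
elemCount _ = 0

size : SDD n → ℕ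
size α = sum (map elemCount (deduplicate _≟S_ (decNodes α)))

-- VS-SDDs (structures are variable-free; offsets are integers)

data VS : Set where
  const : Bool → VS
  lit   : Bool → VS
  dec   : List ((VS × ℤ) × (VS × ℤ)) → VS

-- semantics relative to a fixed vtree T; k is an absolute node ID
module VSSem {n : ℕ} (T : VTree n) where

  mutual
    eval : VS → ℤ → BoolFun n
    eval (const b) k a = b
    eval (lit b) k a with nodeAtℤ T k
    ... | just (leaf X) = if b then a X else not (a X)
    ... | _ = false
    eval (dec es) k a = evalᵉ es k a

    evalᵉ : List ((VS × ℤ) × (VS × ℤ)) → ℤ → BoolFun n
    evalᵉ [] k a = false
    evalᵉ (((p , d) , (s , e)) ∷ es) k a =
      (eval p (d ℤ.+ k) a ∧ eval s (e ℤ.+ k) a) ∨ evalᵉ es k a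

  primesV : List ((VS × ℤ) × (VS × ℤ)) → ℤ → List (BoolFun n)
  primesV es k = map (λ e → eval (proj₁ (proj₁ e)) (proj₂ (proj₁ e) ℤ.+ k)) es

  subsV : List ((VS × ℤ) × (VS × ℤ)) → ℤ → List (BoolFun n)
  subsV es k = map (λ e → eval (proj₁ (proj₂ e)) (proj₂ (proj₂ e) ℤ.+ k)) es

  LeftDesc : ℤ → ℤ → Set
  LeftDesc k m = Σ (VTree n) λ l → Σ (VTree n) λ r → Σ (VTree n) λ y →
    nodeAtℤ T k ≡ just (node l r) × nodeAtℤ T m ≡ just y × Desc y l

  RightDesc : ℤ → ℤ → Set
  RightDesc k m = Σ (VTree n) λ l → Σ (VTree n) λ r → Σ (VTree n) λ y →
    nodeAtℤ T k ≡ just (node l r) × nodeAtℤ T m ≡ just y × Desc y r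

  IsNodeID : ℤ → Set
  IsNodeID k = Σ (VTree n) λ y → nodeAtℤ T k ≡ just y

  mutual
    Valid : VS → ℤ → Set
    Valid (const _) k = ⊤
    Valid (lit _) k = Σ (Fin n) λ X → nodeAtℤ T k ≡ just (leaf X)
    Valid (dec es) k =
        (Σ (VTree n) λ l → Σ (VTree n) λ r → nodeAtℤ T k ≡ just (node l r))
      × ValidElems es k × IsPartition (primesV es k)

    ValidElems : List ((VS × ℤ) × (VS × ℤ)) → ℤ → Set
    ValidElems [] k = ⊤
    ValidElems (((p , d) , (s , e)) ∷ es) k =
        LeftDesc k (d ℤ.+ k) × RightDesc k (e ℤ.+ k)
      × Valid p (d ℤ.+ k) × Valid s (e ℤ.+ k) × ValidElems es k

  mutual
    CompressedV : VS → ℤ → Set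
    CompressedV (const _) k = ⊤
    CompressedV (lit _) k = ⊤
    CompressedV (dec es) k = CompressedVᵉ es k × PairwiseDistinct (subsV es k)

    CompressedVᵉ : List ((VS × ℤ) × (VS × ℤ)) → ℤ → Set
    CompressedVᵉ [] k = ⊤
    CompressedVᵉ (((p , d) , (s , e)) ∷ es) k =
      CompressedV p (d ℤ.+ k) × CompressedV s (e ℤ.+ k) × CompressedVᵉ es k

  -- decomposition nodes, each tagged with the shape of the vtree node at
  -- its absolute offset: identical structures are shared only when their
  -- vtree nodes have isomorphic subtrees
  shapeAt : ℤ → Maybe Shape
  shapeAt k with nodeAtℤ T k
  ... | just y = just (shape y)
  ... | nothing = nothing

  mutual
    decNodesV : VS → ℤ → List (VS × Maybe Shape)
    decNodesV (const _) k = []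
    decNodesV (lit _) k = []
    decNodesV (dec es) k = (dec es , shapeAt k) ∷ decNodesVᵉ es k

    decNodesVᵉ : List ((VS × ℤ) × (VS × ℤ)) → ℤ → List (VS × Maybe Shape)
    decNodesVᵉ [] k = []
    decNodesVᵉ (((p , d) , (s , e)) ∷ es) k =
      Data.List._++_ (decNodesV p (d ℤ.+ k))
        (Data.List._++_ (decNodesV s (e ℤ.+ k)) (decNodesVᵉ es k))

mutual
  _≟V_ : DecidableEquality VS
  const a ≟V const b with a B.≟ b
  ... | yes refl = yes refl
  ... | no ne = no λ { refl → ne refl }
  const _ ≟V lit _ = no λ ()
  const _ ≟V dec _ = no λ ()
  lit _ ≟V const _ = no λ ()
  lit a ≟V lit b with a B.≟ b
  ... | yes refl = yes refl
  ... | no ne = no λ { refl → ne refl }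
  lit _ ≟V dec _ = no λ ()
  dec _ ≟V const _ = no λ ()
  dec _ ≟V lit _ = no λ ()
  dec es ≟V dec fs with es ≟Vs fs
  ... | yes refl = yes refl
  ... | no ne = no λ { refl → ne refl }

  _≟Vs_ : DecidableEquality (List ((VS × ℤ) × (VS × ℤ)))
  [] ≟Vs [] = yes refl
  [] ≟Vs (_ ∷ _) = no λ ()
  (_ ∷ _) ≟Vs [] = no λ ()
  (((p , d) , (s , e)) ∷ es) ≟Vs (((q , d') , (t , e')) ∷ fs)
    with p ≟V q | d ℤ.≟ d' | s ≟V t | e ℤ.≟ e' | es ≟Vs fs
  ... | yes refl | yes refl | yes refl | yes refl | yes refl = yes refl
  ... | no ne | _ | _ | _ | _ = no λ { refl → ne refl }
  ... | _ | no ne | _ | _ | _ = no λ { refl → ne refl }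
  ... | _ | _ | no ne | _ | _ = no λ { refl → ne refl }
  ... | _ | _ | _ | no ne | _ = no λ { refl → ne refl }
  ... | _ | _ | _ | _ | no ne = no λ { refl → ne refl }

elemCountV : VS × Maybe Shape → ℕ
elemCountV (dec es , _) = length es
elemCountV _ = 0

sizeV : {n : ℕ} → VTree n → VS → ℤ → ℕ
sizeV T α k =
  sum (map elemCountV
    (deduplicate (PP.≡-dec _≟V_ (MP.≡-dec _≟Sh_)) (VSSem.decNodesV T α k)))

-- The functions are the conjunctions of 2 ^ j variables.  An SDD changes
-- its value under flipping a variable only if that variable labels a
-- literal, and every literal is the prime or sub of an element of some
-- decomposition node (or is the whole SDD); so an SDD of a function that
-- depends on all n variables has size at least (n - 1) / 2, whatever the
-- vtree.  On the other hand, over a complete vtree of height j the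
-- conjunction of a subtree of height h + 1 decomposes as
-- {(f_l, f_r), (¬f_l, ⊥)} and its negation as {(f_l, ¬f_r), (¬f_l, ⊤)},
-- where f_l and f_r are the conjunctions of the two subtrees of height h.
-- Written with offsets relative to the current vtree node these
-- structures depend on h only, so the VS-SDD shares one structure for
-- the conjunction and one for its negation per height: 2 j decomposition
-- nodes of two elements each.
module Submission where

open import Defs
open import Data.Nat using (ℕ; _≤_; _*_; _^_)
open import Data.Integer using (ℤ)
open import Data.Product using (Σ; _×_)
open import Relation.Binary.PropositionalEquality using (_≡_)

open import Data.Bool as B using (Bool; true; false; _∧_; _∨_; not; if_then_else_)
open import Data.Bool.Properties using (∧-zeroʳ; ∧-inverseʳ; ∨-identityʳ; ∨-inverseʳ; not-¬)
open import Data.Empty using (⊥-elim)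
open import Data.Fin as F using (Fin)
open import Data.Integer using (+_)
open import Data.List as L using (List; []; _∷_; _++_; length; map; concatMap; deduplicate)
open import Data.List.Membership.Propositional using (_∈_)
open import Data.List.Membership.Propositional.Properties
  using (∈-++⁺ˡ; ∈-++⁺ʳ; ∈-++⁻; ∈-concat⁺′; ∈-map⁺; ∈-deduplicate⁺; ∈-deduplicate⁻; ∈-allFin)
open import Data.List.Properties using (length-++; length-removeAt′; length-tabulate)
open import Data.List.Relation.Binary.Permutation.Propositional using (↭-refl; ↭-sym)
open import Data.List.Relation.Binary.Permutation.Propositional.Properties using (∈-resp-↭)
open import Data.List.Relation.Binary.Subset.Propositional using (_⊆_)
open import Data.List.Relation.Unary.All as All using ([]; _∷_)
open import Data.List.Relation.Unary.AllPairs using ([]; _∷_)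
open import Data.List.Relation.Unary.Any as Any using (here; there; _─_)
open import Data.List.Relation.Unary.Unique.Propositional using (Unique)
open import Data.List.Relation.Unary.Unique.Propositional.Properties using (allFin⁺)
import Data.List.Relation.Unary.Unique.DecPropositional.Properties as UniqueDec
open import Data.Maybe using (Maybe; just)
import Data.Maybe.Properties as MP
open import Data.Nat using (zero; suc; _+_; _∸_; _<_; _<ᵇ_; z≤n; s≤s; s<s)
open import Data.Nat.ListAction using (sum)
open import Data.Nat.Properties
open import Data.Product using (_,_; proj₁; proj₂; ∃-syntax)
import Data.Product.Properties as PP
open import Data.Sum using (_⊎_; inj₁; inj₂)
open import Data.Unit using (tt)
open import Data.Vec as V using (Vec; take; drop)
import Data.Vec.Properties as VP
open import Relation.Binary.PropositionalEquality
  using (_≢_; refl; sym; trans; cong; cong₂; subst; module ≡-Reasoning)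
open import Relation.Binary.Definitions using (DecidableEquality)
open import Relation.Nullary using (¬_; yes; no; does)
open import Relation.Nullary.Reflects using (ofʸ; ofⁿ)

private variable
  A : Set
  n h K : ℕ
  x : A
  xs ys zs : List A
  s t l r : VTree n

∈-─ : ∀ {y} (x∈ys : x ∈ ys) → y ∈ ys → y ≢ x → y ∈ (ys ─ x∈ys)
∈-─ (here refl) (here refl)  y≢x = ⊥-elim (y≢x refl)
∈-─ (here refl) (there y∈ys) _   = y∈ys
∈-─ (there _)   (here refl)  _   = here refl
∈-─ (there x∈ys) (there y∈ys) y≢x = there (∈-─ x∈ys y∈ys y≢x)

Unique-⊆⇒length≤ : Unique xs → xs ⊆ ys → length xs ≤ length ys
Unique-⊆⇒length≤ {xs = []} [] _ = z≤n
Unique-⊆⇒length≤ {xs = x ∷ xs} {ys = ys} (x∉xs ∷ unique) xs⊆ys = begin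
  suc (length xs)          ≤⟨ s≤s (Unique-⊆⇒length≤ unique xs⊆ys─x) ⟩
  suc (length (ys ─ x∈ys)) ≡⟨ length-removeAt′ ys (Any.index x∈ys) ⟨
  length ys                ∎
  where
  open ≤-Reasoning
  x∈ys = xs⊆ys (here refl)
  xs⊆ys─x : xs ⊆ (ys ─ x∈ys)
  xs⊆ys─x y∈xs = ∈-─ x∈ys (xs⊆ys (there y∈xs)) (λ { refl → All.lookup x∉xs y∈xs refl })

++-⊆ : xs ⊆ zs → ys ⊆ zs → xs ++ ys ⊆ zs
++-⊆ {xs = xs} xs⊆zs ys⊆zs z∈ with ∈-++⁻ xs z∈
... | inj₁ z∈xs = xs⊆zs z∈xs
... | inj₂ z∈ys = ys⊆zs z∈ys

sum-map-≤ : (f : A → ℕ) {b : ℕ} (xs : List A) →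
            (∀ {x} → x ∈ xs → f x ≤ b) → sum (map f xs) ≤ length xs * b
sum-map-≤ f []       _     = z≤n
sum-map-≤ f (x ∷ xs) f≤b = +-mono-≤ (f≤b (here refl)) (sum-map-≤ f xs (λ y∈xs → f≤b (there y∈xs)))

-- Lower bound for SDDs

DependsOn : BoolFun n → Fin n → Set
DependsOn {n} f X = ∃[ a ] ∃[ a′ ] (∀ Y → Y ≢ X → a Y ≡ a′ Y) × f a ≢ f a′

litVar : SDD n → List (Fin n)
litVar (lit _ X) = X ∷ []
litVar _         = []

elemLitVars : SDD n → List (Fin n)
elemLitVars (dec es) = concatMap (λ e → litVar (proj₁ e) ++ litVar (proj₂ e)) es
elemLitVars _        = []

literalVars : SDD n → List (Fin n)
literalVars α = litVar α ++ concatMap elemLitVars (deduplicate _≟S_ (decNodes α))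

length-litVar : (α : SDD n) → length (litVar α) ≤ 1
length-litVar (const _) = z≤n
length-litVar (lit _ _) = s≤s z≤n
length-litVar (dec _)   = z≤n

length-elemLitVars : (α : SDD n) → length (elemLitVars α) ≤ elemCount α * 2
length-elemLitVars (const _)           = z≤n
length-elemLitVars (lit _ _)           = z≤n
length-elemLitVars (dec [])            = z≤n
length-elemLitVars (dec ((p , s) ∷ es)) = begin
  length ((litVar p ++ litVar s) ++ elemLitVars (dec es))
    ≡⟨ length-++ (litVar p ++ litVar s) ⟩
  length (litVar p ++ litVar s) + length (elemLitVars (dec es))
    ≡⟨ cong (_+ length (elemLitVars (dec es))) (length-++ (litVar p)) ⟩
  length (litVar p) + length (litVar s) + length (elemLitVars (dec es))
    ≤⟨ +-mono-≤ (+-mono-≤ (length-litVar p) (length-litVar s)) (length-elemLitVars (dec es)) ⟩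
  2 + length es * 2 ∎
  where open ≤-Reasoning

length-concatMap-elemLitVars : (Ds : List (SDD n)) →
  length (concatMap elemLitVars Ds) ≤ sum (map elemCount Ds) * 2
length-concatMap-elemLitVars []       = z≤n
length-concatMap-elemLitVars (D ∷ Ds) = begin
  length (elemLitVars D ++ concatMap elemLitVars Ds)
    ≡⟨ length-++ (elemLitVars D) ⟩
  length (elemLitVars D) + length (concatMap elemLitVars Ds)
    ≤⟨ +-mono-≤ (length-elemLitVars D) (length-concatMap-elemLitVars Ds) ⟩
  elemCount D * 2 + sum (map elemCount Ds) * 2
    ≡⟨ *-distribʳ-+ 2 (elemCount D) _ ⟨
  (elemCount D + sum (map elemCount Ds)) * 2 ∎
  where open ≤-Reasoning

length-literalVars : (α : SDD n) → length (literalVars α) ≤ 1 + size α * 2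
length-literalVars α = begin
  length (literalVars α)
    ≡⟨ length-++ (litVar α) ⟩
  length (litVar α) + length (concatMap elemLitVars (deduplicate _≟S_ (decNodes α)))
    ≤⟨ +-mono-≤ (length-litVar α) (length-concatMap-elemLitVars (deduplicate _≟S_ (decNodes α))) ⟩
  1 + size α * 2 ∎
  where open ≤-Reasoning

module _ {X : Fin n} {a a′ : Fin n → Bool} (agree : ∀ Y → Y ≢ X → a Y ≡ a′ Y) where

  mutual
    changes⇒literal : (α : SDD n) → ⟦ α ⟧ a ≢ ⟦ α ⟧ a′ →
      X ∈ litVar α ⊎ ∃[ D ] D ∈ decNodes α × X ∈ elemLitVars D
    changes⇒literal (const _) ≢ = ⊥-elim (≢ refl)
    changes⇒literal (lit b Y) ≢ with Y F.≟ X
    ... | yes refl = inj₁ (here refl)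
    ... | no Y≢X   = ⊥-elim (≢ (cong (λ v → if b then v else not v) (agree Y Y≢X)))
    changes⇒literal (dec es) ≢ with changesᵉ⇒literal es ≢
    ... | inj₁ X∈          = inj₂ (dec es , here refl , X∈)
    ... | inj₂ (D , D∈ , X∈) = inj₂ (D , there D∈ , X∈)

    changesᵉ⇒literal : (es : List (SDD n × SDD n)) → ⟦ es ⟧ᵉ a ≢ ⟦ es ⟧ᵉ a′ →
      X ∈ elemLitVars (dec es) ⊎ ∃[ D ] D ∈ decNodesᵉ es × X ∈ elemLitVars D
    changesᵉ⇒literal [] ≢ = ⊥-elim (≢ refl)
    changesᵉ⇒literal ((p , s) ∷ es) ≢
      with ⟦ p ⟧ a B.≟ ⟦ p ⟧ a′ | ⟦ s ⟧ a B.≟ ⟦ s ⟧ a′ | ⟦ es ⟧ᵉ a B.≟ ⟦ es ⟧ᵉ a′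
    ... | yes p≡ | yes s≡ | yes es≡ = ⊥-elim (≢ (cong₂ _∨_ (cong₂ _∧_ p≡ s≡) es≡))
    ... | no p≢ | _ | _ with changes⇒literal p p≢
    ...   | inj₁ X∈          = inj₁ (∈-++⁺ˡ (∈-++⁺ˡ X∈))
    ...   | inj₂ (D , D∈ , X∈) = inj₂ (D , ∈-++⁺ˡ D∈ , X∈)
    changesᵉ⇒literal ((p , s) ∷ es) ≢ | yes _ | no s≢ | _ with changes⇒literal s s≢
    ...   | inj₁ X∈          = inj₁ (∈-++⁺ˡ (∈-++⁺ʳ (litVar p) X∈))
    ...   | inj₂ (D , D∈ , X∈) = inj₂ (D , ∈-++⁺ʳ (decNodes p) (∈-++⁺ˡ D∈) , X∈)
    changesᵉ⇒literal ((p , s) ∷ es) ≢ | yes _ | yes _ | no es≢ with changesᵉ⇒literal es es≢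
    ...   | inj₁ X∈          = inj₁ (∈-++⁺ʳ (litVar p ++ litVar s) X∈)
    ...   | inj₂ (D , D∈ , X∈) = inj₂ (D , ∈-++⁺ʳ (decNodes p) (∈-++⁺ʳ (decNodes s) D∈) , X∈)

dependsOn⇒∈literalVars : (α : SDD n) {X : Fin n} → DependsOn ⟦ α ⟧ X → X ∈ literalVars α
dependsOn⇒∈literalVars α (a , a′ , agree , ≢) with changes⇒literal agree α ≢
... | inj₁ X∈          = ∈-++⁺ˡ X∈
... | inj₂ (D , D∈ , X∈) = ∈-++⁺ʳ (litVar α)
  (∈-concat⁺′ X∈ (∈-map⁺ elemLitVars (∈-deduplicate⁺ _≟S_ D∈)))

dependsOnAll⇒n≤1+size*2 : (α : SDD n) → (∀ X → DependsOn ⟦ α ⟧ X) → n ≤ 1 + size α * 2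
dependsOnAll⇒n≤1+size*2 {n} α dependsOn = begin
  n                        ≡⟨ length-tabulate {n = n} (λ X → X) ⟨
  length (L.allFin n)      ≤⟨ Unique-⊆⇒length≤ (allFin⁺ n)
                                (λ {X} _ → dependsOn⇒∈literalVars α (dependsOn X)) ⟩
  length (literalVars α)   ≤⟨ length-literalVars α ⟩
  1 + size α * 2           ∎
  where open ≤-Reasoning

2≤m≤1+n*2⇒m≤3*n : ∀ {m} n → 2 ≤ m → m ≤ 1 + n * 2 → m ≤ 3 * n
2≤m≤1+n*2⇒m≤3*n zero    (s≤s (s≤s _)) (s≤s ())
2≤m≤1+n*2⇒m≤3*n (suc n) _ m≤ = ≤-trans m≤ (begin
  1 + suc n * 2       ≤⟨ +-monoˡ-≤ (suc n * 2) (s≤s z≤n) ⟩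
  suc n + suc n * 2   ≡⟨ cong (λ k → suc n + k) (*-comm (suc n) 2) ⟩
  3 * suc n           ∎)
  where open ≤-Reasoning

<ᵇ-false : ∀ {m n} → n ≤ m → (m <ᵇ n) ≡ false
<ᵇ-false {m} {n} n≤m with m <ᵇ n | <ᵇ-reflects-< m n
... | false | _       = refl
... | true  | ofʸ m<n = ⊥-elim (<⇒≱ m<n n≤m)

<ᵇ-true : ∀ {m n} → m < n → (m <ᵇ n) ≡ true
<ᵇ-true {m} {n} m<n with m <ᵇ n | <ᵇ-reflects-< m n
... | true  | _       = refl
... | false | ofⁿ m≮n = ⊥-elim (m≮n m<n)

nodeAt-count : (t : VTree n) (i : ℕ) → nodeAt t i ≡ just s → i + count s ≤ count t
nodeAt-count t zero refl = ≤-refl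
nodeAt-count {s = s} (node l r) (suc i) e with i <ᵇ count l | <ᵇ-reflects-< i (count l)
... | true  | _        = s≤s (≤-trans (nodeAt-count l i e) (m≤m+n _ _))
... | false | ofⁿ i≮l = s≤s (begin
  i + count s                       ≡⟨ cong (_+ count s) (m+[n∸m]≡n (≮⇒≥ i≮l)) ⟨
  count l + (i ∸ count l) + count s ≡⟨ +-assoc (count l) _ _ ⟩
  count l + (i ∸ count l + count s) ≤⟨ +-monoʳ-≤ (count l) (nodeAt-count r (i ∸ count l) e) ⟩
  count l + count r                 ∎)
  where open ≤-Reasoning

nodeAt-+ : (t : VTree n) (i m : ℕ) → nodeAt t i ≡ just s → m < count s →
           nodeAt t (i + m) ≡ nodeAt s m
nodeAt-+ t zero m refl _ = refl
nodeAt-+ (node l r) (suc i) m e m<s with i <ᵇ count l | <ᵇ-reflects-< i (count l)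
... | true | _
  rewrite <ᵇ-true (<-≤-trans (+-monoʳ-< i m<s) (nodeAt-count l i e)) = nodeAt-+ l i m e m<s
... | false | ofⁿ i≮l
  rewrite <ᵇ-false (≤-trans (≮⇒≥ i≮l) (m≤m+n i m)) | +-∸-comm m (≮⇒≥ i≮l)
  = nodeAt-+ r (i ∸ count l) m e m<s

count≥1 : (t : VTree n) → 1 ≤ count t
count≥1 (leaf _)   = s≤s z≤n
count≥1 (node _ _) = s≤s z≤n

nodeAt-left : (T : VTree n) → nodeAt T K ≡ just (node l r) → nodeAt T (suc K) ≡ just l
nodeAt-left {K = K} {l = l} {r = r} T e = begin
  nodeAt T (suc K)    ≡⟨ cong (nodeAt T) (+-comm 1 K) ⟩
  nodeAt T (K + 1)    ≡⟨ nodeAt-+ T K 1 e (s<s (≤-trans (count≥1 l) (m≤m+n _ _))) ⟩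
  nodeAt (node l r) 1 ≡⟨ first-child ⟩
  just l              ∎
  where
  open ≡-Reasoning
  first-child : nodeAt (node l r) 1 ≡ just l
  first-child rewrite <ᵇ-true (count≥1 l) = refl

nodeAt-right : (T : VTree n) → nodeAt T K ≡ just (node l r) →
               nodeAt T (suc (count l + K)) ≡ just r
nodeAt-right {K = K} {l = l} {r = r} T e = begin
  nodeAt T (suc (count l + K))      ≡⟨ cong (nodeAt T) index-eq ⟨
  nodeAt T (K + suc (count l))      ≡⟨ nodeAt-+ T K (suc (count l)) e (s<s (m<m+n (count l) (count≥1 r))) ⟩
  nodeAt (node l r) (suc (count l)) ≡⟨ second-child ⟩
  just r                            ∎
  where
  open ≡-Reasoning
  index-eq : K + suc (count l) ≡ suc (count l + K)
  index-eq = trans (+-suc K (count l)) (cong suc (+-comm K (count l)))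
  second-child : nodeAt (node l r) (suc (count l)) ≡ just r
  second-child rewrite <ᵇ-false (≤-refl {count l}) | n∸n≡0 (count l) = refl

data Balanced {n : ℕ} : ℕ → VTree n → Set where
  leaf : ∀ {X} → Balanced 0 (leaf X)
  node : Balanced h l → Balanced h r → Balanced (suc h) (node l r)

balancedCount : ℕ → ℕ
balancedCount zero    = 1
balancedCount (suc h) = suc (balancedCount h + balancedCount h)

balancedShape : ℕ → Shape
balancedShape zero    = sleaf
balancedShape (suc h) = snode (balancedShape h) (balancedShape h)

count-balanced : Balanced h t → count t ≡ balancedCount h
count-balanced leaf         = refl
count-balanced (node bl br) = cong suc (cong₂ _+_ (count-balanced bl) (count-balanced br))

shape-balanced : Balanced h t → shape t ≡ balancedShape h
shape-balanced leaf         = refl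
shape-balanced (node bl br) = cong₂ snode (shape-balanced bl) (shape-balanced br)

-- 2 ^ h, unfolded so that a vector of length pow2 (suc h) splits into two
-- halves without any rewriting.
pow2 : ℕ → ℕ
pow2 zero    = 1
pow2 (suc h) = pow2 h + pow2 h

pow2≡2^ : ∀ h → pow2 h ≡ 2 ^ h
pow2≡2^ zero    = refl
pow2≡2^ (suc h) = cong₂ _+_ (pow2≡2^ h) (trans (pow2≡2^ h) (sym (+-identityʳ (2 ^ h))))

completeVtree : ∀ h → Vec (Fin n) (pow2 h) → VTree n
completeVtree zero    (X V.∷ V.[]) = leaf X
completeVtree (suc h) v = node (completeVtree h (take (pow2 h) v)) (completeVtree h (drop (pow2 h) v))

balanced-completeVtree : ∀ h (v : Vec (Fin n) (pow2 h)) → Balanced h (completeVtree h v)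
balanced-completeVtree zero    (X V.∷ V.[]) = leaf
balanced-completeVtree (suc h) v = node (balanced-completeVtree h _) (balanced-completeVtree h _)

leaves-completeVtree : ∀ h (v : Vec (Fin n) (pow2 h)) → leaves (completeVtree h v) ≡ V.toList v
leaves-completeVtree zero    (X V.∷ V.[]) = refl
leaves-completeVtree (suc h) v = begin
  leaves (completeVtree h (take (pow2 h) v)) ++ leaves (completeVtree h (drop (pow2 h) v))
    ≡⟨ cong₂ _++_ (leaves-completeVtree h _) (leaves-completeVtree h _) ⟩
  V.toList (take (pow2 h) v) ++ V.toList (drop (pow2 h) v)
    ≡⟨ VP.toList-++ (take (pow2 h) v) (drop (pow2 h) v) ⟨
  V.toList (take (pow2 h) v V.++ drop (pow2 h) v)
    ≡⟨ cong V.toList (VP.take++drop≡id (pow2 h) v) ⟩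
  V.toList v ∎
  where open ≡-Reasoning

toList-tabulate : (f : Fin n → A) → V.toList (V.tabulate f) ≡ L.tabulate f
toList-tabulate {n = zero}  f = refl
toList-tabulate {n = suc n} f = cong (f F.zero ∷_) (toList-tabulate (λ X → f (F.suc X)))

allVarsVtree : ∀ j → VTree (pow2 j)
allVarsVtree j = completeVtree j (V.allFin (pow2 j))

allVarsVtree-isVtree : ∀ j → IsVtree (allVarsVtree j)
allVarsVtree-isVtree j rewrite leaves-completeVtree j (V.allFin (pow2 j))
                      | toList-tabulate {n = pow2 j} (λ X → X) = ↭-refl

leafConj : VTree n → BoolFun n
leafConj (leaf X)   a = a X
leafConj (node l r) a = leafConj l a ∧ leafConj r a

leafConj-true : (t : VTree n) → leafConj t (λ _ → true) ≡ true
leafConj-true (leaf _)   = refl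
leafConj-true (node l r) = cong₂ _∧_ (leafConj-true l) (leafConj-true r)

leafConj-false : (t : VTree n) → leafConj t (λ _ → false) ≡ false
leafConj-false (leaf _)   = refl
leafConj-false (node l r) = cong (_∧ leafConj r (λ _ → false)) (leafConj-false l)

leafConj-∈ : (t : VTree n) (a : Fin n → Bool) {X : Fin n} →
             X ∈ leaves t → a X ≡ false → leafConj t a ≡ false
leafConj-∈ (leaf _) a (here refl) aX≡false = aX≡false
leafConj-∈ (node l r) a X∈ aX≡false with ∈-++⁻ (leaves l) X∈
... | inj₁ X∈l = cong (_∧ leafConj r a) (leafConj-∈ l a X∈l aX≡false)
... | inj₂ X∈r = trans (cong (leafConj l a ∧_) (leafConj-∈ r a X∈r aX≡false)) (∧-zeroʳ _)

leafConj-dependsOn : (t : VTree n) {X : Fin n} → X ∈ leaves t → DependsOn (leafConj t) X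
leafConj-dependsOn t {X} X∈ = (λ _ → true) , flipX , agree , differ
  where
  flipX : Fin _ → Bool
  flipX Y = not (does (Y F.≟ X))
  agree : ∀ Y → Y ≢ X → true ≡ flipX Y
  agree Y Y≢X with Y F.≟ X
  ... | yes Y≡X = ⊥-elim (Y≢X Y≡X)
  ... | no  _   = refl
  flipX-X : flipX X ≡ false
  flipX-X with X F.≟ X
  ... | yes _   = refl
  ... | no  X≢X = ⊥-elim (X≢X refl)
  differ : leafConj t (λ _ → true) ≢ leafConj t flipX
  differ eq with trans (trans (sym (leafConj-true t)) eq) (leafConj-∈ t flipX X∈ flipX-X)
  ... | ()

-- VS-SDDs for the conjunction over a complete vtree

-- Offsets are distances in preorder: the left child of a node comes right
-- after it, the right child after the whole left subtree.
mutual
  conjVS : ℕ → VS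
  conjVS zero    = lit true
  conjVS (suc h) = dec (((conjVS h , + 1) , (conjVS h , + suc (balancedCount h)))
                      ∷ ((nandVS h , + 1) , (const false , + suc (balancedCount h))) ∷ [])

  nandVS : ℕ → VS
  nandVS zero    = lit false
  nandVS (suc h) = dec (((conjVS h , + 1) , (nandVS h , + suc (balancedCount h)))
                      ∷ ((nandVS h , + 1) , (const true , + suc (balancedCount h))) ∷ [])

complement-isPartition : (p q : BoolFun n) → (∀ a → q a ≡ not (p a)) →
  ∀ {a b} → p a ≡ true → p b ≡ false → IsPartition (p ∷ q ∷ [])
complement-isPartition p q q≡¬p {a} {b} pa pb =
  ((λ c → disjoint c) ∷ []) ∷ [] ∷ [] , covering , p≢false ∷ q≢false ∷ []
  where
  disjoint : ∀ c → (p c ∧ q c) ≡ false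
  disjoint c = trans (cong (p c ∧_) (q≡¬p c)) (∧-inverseʳ (p c))
  covering : ∀ c → (p c ∨ (q c ∨ false)) ≡ true
  covering c = trans (cong (p c ∨_) (trans (∨-identityʳ (q c)) (q≡¬p c))) (∨-inverseʳ (p c))
  p≢false : ¬ (∀ c → p c ≡ false)
  p≢false p≡false with trans (sym pa) (p≡false a)
  ... | ()
  q≢false : ¬ (∀ c → q c ≡ false)
  q≢false q≡false with trans (sym (trans (q≡¬p b) (cong not pb))) (q≡false b)
  ... | ()

distinct-at : (s t : BoolFun n) {a : Fin n → Bool} {b : Bool} → s a ≡ b → t a ≡ not b →
              PairwiseDistinct (s ∷ t ∷ [])
distinct-at s t {a} sa≡b ta≡¬b =
  ((λ s≡t → not-¬ refl (trans (sym sa≡b) (trans (s≡t a) ta≡¬b))) ∷ []) ∷ [] ∷ []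

∧-decomposition : ∀ {p p′ s x y} → p ≡ x → p′ ≡ not x → s ≡ y →
                  (p ∧ s) ∨ ((p′ ∧ false) ∨ false) ≡ x ∧ y
∧-decomposition {x = true}  refl refl refl = ∨-identityʳ _
∧-decomposition {x = false} refl refl refl = refl

nand-decomposition : ∀ {p p′ s x y} → p ≡ x → p′ ≡ not x → s ≡ not y →
                     (p ∧ s) ∨ ((p′ ∧ true) ∨ false) ≡ not (x ∧ y)
nand-decomposition {x = true}  refl refl refl = ∨-identityʳ _
nand-decomposition {x = false} refl refl refl = refl

sharedDecNodes : ℕ → List (VS × Maybe Shape)
sharedDecNodes zero    = []
sharedDecNodes (suc h) = (conjVS (suc h) , just (balancedShape (suc h)))
                   ∷ (nandVS (suc h) , just (balancedShape (suc h))) ∷ sharedDecNodes h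

length-sharedDecNodes : ∀ h → length (sharedDecNodes h) ≡ h * 2
length-sharedDecNodes zero    = refl
length-sharedDecNodes (suc h) = cong (λ k → suc (suc k)) (length-sharedDecNodes h)

elemCountV-sharedDecNodes : ∀ h {D} → D ∈ sharedDecNodes h → elemCountV D ≤ 2
elemCountV-sharedDecNodes (suc h) (here refl)         = ≤-refl
elemCountV-sharedDecNodes (suc h) (there (here refl)) = ≤-refl
elemCountV-sharedDecNodes (suc h) (there (there D∈))  = elemCountV-sharedDecNodes h D∈

module _ {M : ℕ} (T : VTree M) where
  open VSSem T

  nodeAt-right-balanced : nodeAt T K ≡ just (node l r) → Balanced h l →
                          nodeAt T (suc (balancedCount h + K)) ≡ just r
  nodeAt-right-balanced e bl rewrite sym (count-balanced bl) = nodeAt-right T e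

  mutual
    eval-conjVS : ∀ h → nodeAt T K ≡ just t → Balanced h t →
                  ∀ a → eval (conjVS h) (+ K) a ≡ leafConj t a
    eval-conjVS zero e leaf a rewrite e = refl
    eval-conjVS (suc h) e (node bl br) a = ∧-decomposition
      (eval-conjVS h (nodeAt-left T e) bl a)
      (eval-nandVS h (nodeAt-left T e) bl a)
      (eval-conjVS h (nodeAt-right-balanced e bl) br a)

    eval-nandVS : ∀ h → nodeAt T K ≡ just t → Balanced h t →
                  ∀ a → eval (nandVS h) (+ K) a ≡ not (leafConj t a)
    eval-nandVS zero e leaf a rewrite e = refl
    eval-nandVS (suc h) e (node bl br) a = nand-decomposition
      (eval-conjVS h (nodeAt-left T e) bl a)
      (eval-nandVS h (nodeAt-left T e) bl a)
      (eval-nandVS h (nodeAt-right-balanced e bl) br a)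

  left-partition : nodeAt T K ≡ just (node l r) → Balanced h l →
    IsPartition (eval (conjVS h) (+ suc K) ∷ eval (nandVS h) (+ suc K) ∷ [])
  left-partition {l = l} e bl = complement-isPartition _ _
    (λ a → trans (eval-nandVS _ lc bl a) (cong not (sym (eval-conjVS _ lc bl a))))
    (trans (eval-conjVS _ lc bl _) (leafConj-true l))
    (trans (eval-conjVS _ lc bl _) (leafConj-false l))
    where lc = nodeAt-left T e

  leftDesc-child : nodeAt T K ≡ just (node l r) → LeftDesc (+ K) (+ suc K)
  leftDesc-child {l = l} {r = r} e = l , r , l , e , nodeAt-left T e , here

  rightDesc-child : nodeAt T K ≡ just (node l r) → Balanced h l →
                    RightDesc (+ K) (+ suc (balancedCount h + K))
  rightDesc-child {l = l} {r = r} e bl = l , r , r , e , nodeAt-right-balanced e bl , here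

  mutual
    valid-conjVS : ∀ h → nodeAt T K ≡ just t → Balanced h t → Valid (conjVS h) (+ K)
    valid-conjVS zero e (leaf {X}) = X , e
    valid-conjVS {t = node l r} (suc h) e (node bl br) =
      (l , r , e) ,
      ( leftDesc-child e , rightDesc-child e bl
      , valid-conjVS h (nodeAt-left T e) bl , valid-conjVS h (nodeAt-right-balanced e bl) br
      , leftDesc-child e , rightDesc-child e bl
      , valid-nandVS h (nodeAt-left T e) bl , tt , tt) ,
      left-partition e bl

    valid-nandVS : ∀ h → nodeAt T K ≡ just t → Balanced h t → Valid (nandVS h) (+ K)
    valid-nandVS zero e (leaf {X}) = X , e
    valid-nandVS {t = node l r} (suc h) e (node bl br) =
      (l , r , e) ,
      ( leftDesc-child e , rightDesc-child e bl
      , valid-conjVS h (nodeAt-left T e) bl , valid-nandVS h (nodeAt-right-balanced e bl) br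
      , leftDesc-child e , rightDesc-child e bl
      , valid-nandVS h (nodeAt-left T e) bl , tt , tt) ,
      left-partition e bl

  mutual
    compressed-conjVS : ∀ h → nodeAt T K ≡ just t → Balanced h t → CompressedV (conjVS h) (+ K)
    compressed-conjVS zero _ leaf = tt
    compressed-conjVS {t = node l r} (suc h) e (node bl br) =
      ( compressed-conjVS h (nodeAt-left T e) bl
      , compressed-conjVS h (nodeAt-right-balanced e bl) br
      , compressed-nandVS h (nodeAt-left T e) bl , tt , tt) ,
      distinct-at _ _ (trans (eval-conjVS h (nodeAt-right-balanced e bl) br _) (leafConj-true r)) refl

    compressed-nandVS : ∀ h → nodeAt T K ≡ just t → Balanced h t → CompressedV (nandVS h) (+ K)
    compressed-nandVS zero _ leaf = tt
    compressed-nandVS {t = node l r} (suc h) e (node bl br) =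
      ( compressed-conjVS h (nodeAt-left T e) bl
      , compressed-nandVS h (nodeAt-right-balanced e bl) br
      , compressed-nandVS h (nodeAt-left T e) bl , tt , tt) ,
      distinct-at _ _ (trans (eval-nandVS h (nodeAt-right-balanced e bl) br _) (cong not (leafConj-true r))) refl

  shapeAt-balanced : nodeAt T K ≡ just t → Balanced h t → shapeAt (+ K) ≡ just (balancedShape h)
  shapeAt-balanced e b rewrite e = cong just (shape-balanced b)

  mutual
    decNodesV-conjVS : ∀ h → nodeAt T K ≡ just t → Balanced h t →
                       decNodesV (conjVS h) (+ K) ⊆ sharedDecNodes h
    decNodesV-conjVS zero _ leaf ()
    decNodesV-conjVS {K = K} (suc h) e b (here refl) =
      here (cong (conjVS (suc h) ,_) (shapeAt-balanced {K = K} e b))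
    decNodesV-conjVS (suc h) e (node bl br) (there D∈) = there (there (
      ++-⊆ (decNodesV-conjVS h (nodeAt-left T e) bl)
     (++-⊆ (decNodesV-conjVS h (nodeAt-right-balanced e bl) br)
     (++-⊆ (decNodesV-nandVS h (nodeAt-left T e) bl) λ ())) D∈))

    decNodesV-nandVS : ∀ h → nodeAt T K ≡ just t → Balanced h t →
                       decNodesV (nandVS h) (+ K) ⊆ sharedDecNodes h
    decNodesV-nandVS zero _ leaf ()
    decNodesV-nandVS {K = K} (suc h) e b (here refl) =
      there (here (cong (nandVS (suc h) ,_) (shapeAt-balanced {K = K} e b)))
    decNodesV-nandVS (suc h) e (node bl br) (there D∈) = there (there (
      ++-⊆ (decNodesV-conjVS h (nodeAt-left T e) bl)
     (++-⊆ (decNodesV-nandVS h (nodeAt-right-balanced e bl) br)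
     (++-⊆ (decNodesV-nandVS h (nodeAt-left T e) bl) λ ())) D∈))

  sizeV-conjVS : ∀ h → nodeAt T K ≡ just t → Balanced h t → sizeV T (conjVS h) (+ K) ≤ h * 2 * 2
  sizeV-conjVS {K = K} h e b = begin
    sum (map elemCountV D) ≤⟨ sum-map-≤ elemCountV D (λ D∈ → elemCountV-sharedDecNodes h (D⊆ D∈)) ⟩
    length D * 2           ≤⟨ *-monoˡ-≤ 2 (Unique-⊆⇒length≤ (UniqueDec.deduplicate-! _≟D_ _) D⊆) ⟩
    length (sharedDecNodes h) * 2 ≡⟨ cong (_* 2) (length-sharedDecNodes h) ⟩
    h * 2 * 2              ∎
    where
    open ≤-Reasoning
    _≟D_ : DecidableEquality (VS × Maybe Shape)
    _≟D_ = PP.≡-dec _≟V_ (MP.≡-dec _≟Sh_)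
    D = deduplicate _≟D_ (decNodesV (conjVS h) (+ K))
    D⊆ : D ⊆ sharedDecNodes h
    D⊆ D∈ = decNodesV-conjVS h e b (∈-deduplicate⁻ _≟D_ _ D∈)

pow2≥2 : ∀ j → 2 ≤ pow2 (suc j)
pow2≥2 j = +-mono-≤ pow2>0 pow2>0
  where
  pow2>0 : 0 < pow2 j
  pow2>0 = subst (0 <_) (sym (pow2≡2^ j)) (m^n>0 2 j)

DependsOn-resp : {f g : BoolFun n} {X : Fin n} → (∀ a → f a ≡ g a) → DependsOn g X → DependsOn f X
DependsOn-resp f≡g (a , a′ , agree , ga≢ga′) =
  a , a′ , agree , λ fa≡fa′ → ga≢ga′ (trans (sym (f≡g a)) (trans fa≡fa′ (f≡g a′)))

sdd-size-leafConj : ∀ j (α : SDD (pow2 (suc j))) → (∀ a → ⟦ α ⟧ a ≡ leafConj (allVarsVtree (suc j)) a) →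
                    2 ^ suc j ≤ 3 * size α
sdd-size-leafConj j α α≡conj = subst (_≤ 3 * size α) (pow2≡2^ (suc j))
  (2≤m≤1+n*2⇒m≤3*n (size α) (pow2≥2 j) (dependsOnAll⇒n≤1+size*2 α dependsOn))
  where
  dependsOn : ∀ X → DependsOn ⟦ α ⟧ X
  dependsOn X = DependsOn-resp α≡conj (leafConj-dependsOn (allVarsVtree (suc j))
    (∈-resp-↭ (↭-sym (allVarsVtree-isVtree (suc j))) (∈-allFin X)))

theorem4 :
  Σ (ℕ → ℕ) λ N → Σ ((j : ℕ) → BoolFun (N j)) λ f →
    -- f j uses O(2^j) variables
    (Σ ℕ λ C → Σ ℕ λ j₀ → (j : ℕ) → j₀ ≤ j → N j ≤ C * 2 ^ j)
    -- every compressed SDD for f j (w.r.t. any vtree) has size Ω(2^j)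
    × (Σ ℕ λ c → Σ ℕ λ j₀ → (j : ℕ) → j₀ ≤ j →
        (T : VTree (N j)) → IsVtree T →
        (α : SDD (N j)) →
        (Σ (VTree (N j)) λ x → Desc x T × Respects α x) →
        Compressed α →
        ((a : _) → ⟦ α ⟧ a ≡ f j a) →
        2 ^ j ≤ c * size α)
    -- some vtree admits a compressed VS-SDD for f j of size O(j)
    × (Σ ℕ λ C → Σ ℕ λ j₀ → (j : ℕ) → j₀ ≤ j →
        Σ (VTree (N j)) λ T → IsVtree T ×
        Σ VS λ α → Σ ℤ λ k →
          VSSem.IsNodeID T k × VSSem.Valid T α k × VSSem.CompressedV T α k
          × ((a : _) → VSSem.eval T α k a ≡ f j a)
          × sizeV T α k ≤ C * j)
theorem4 =
  pow2 , (λ j → leafConj (allVarsVtree j)) ,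
  (1 , 0 , λ j _ → ≤-reflexive (trans (pow2≡2^ j) (sym (*-identityˡ (2 ^ j))))) ,
  (3 , 1 , λ { (suc j) _ _ _ α _ _ α≡conj → sdd-size-leafConj j α α≡conj }) ,
  (4 , 0 , λ j _ →
    let B = balanced-completeVtree j (V.allFin (pow2 j)) in
    allVarsVtree j , allVarsVtree-isVtree j , conjVS j , + 0 , (allVarsVtree j , refl) ,
    valid-conjVS (allVarsVtree j) j refl B , compressed-conjVS (allVarsVtree j) j refl B ,
    eval-conjVS (allVarsVtree j) j refl B ,
    ≤-trans (sizeV-conjVS (allVarsVtree j) j refl B) (≤-reflexive (trans (*-assoc j 2 2) (*-comm j 4))))
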